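{- Let $(G,\sigma)$ and $(G,\sigma')$ be two associated signed graphs obtained from a bipartite oriented graph $\overrightarrow{G}$ (possibly using different bipartitions). Then $(G,\sigma)$ is switch equivalent to $(G,\sigma')$.
   Context: A signed graph $(G,\sigma)$ is a graph with $\sigma:E(G)\to\{+,-\}$. To switch a vertex is to change the signs of all its incident edges; switching a set switches each vertex once; switch equivalent means obtainable from each other by switching a vertex set. Given a bipartite oriented graph $\overrightarrow{G}$ (no loops, at most one arc between two vertices) and a bipartition $V=A\cup B$ into independent sets, its associated signed graph has the same underlying graph, an edge being positive if its arc goes from $A$ to $B$ and negative if it goes from $B$ to $A$. -}

module Defs where

open import Data.Nat using (ℕ)
open import Data.Fin using (Fin)
open import Data.Bool using (Bool; true; false; _xor_)
open import Data.Product using (Σ; _×_)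
open import Relation.Binary.PropositionalEquality using (_≡_)
open import Relation.Nullary using (¬_)

-- Signs: false = positive (+), true = negative (-).
Sign : Set
Sign = Bool

record OrientedGraph (n : ℕ) : Set where
  field
    Arc        : Fin n → Fin n → Bool
    noLoop     : ∀ u → Arc u u ≡ false
    antisym    : ∀ u v → Arc u v ≡ true → Arc v u ≡ false
open OrientedGraph public

-- Underlying (undirected) graph: u ~ v iff there is an arc u → v or v → u.
-- Each edge {u,v} corresponds to exactly one arc, so a signature on the
-- underlying graph is given by a sign for each arc (u,v), read as the sign
-- of the edge {u,v}.
Signature : ∀ {n} → OrientedGraph n → Set
Signature {n} G = (u v : Fin n) → Arc G u v ≡ true → Sign

-- A bipartition V = A ∪ B into independent sets: side u ≡ false means u ∈ A,
-- side u ≡ true means u ∈ B; every edge joins A and B.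
IsBipartition : ∀ {n} → OrientedGraph n → (Fin n → Bool) → Set
IsBipartition {n} G side = ∀ (u v : Fin n) → Arc G u v ≡ true → ¬ (side u ≡ side v)

-- Associated signature: the edge of arc u → v is positive iff u ∈ A (arc goes
-- from A to B) and negative iff u ∈ B (arc goes from B to A).
associated : ∀ {n} (G : OrientedGraph n) → (Fin n → Bool) → Signature G
associated G side u v _ = side u

switch : ∀ {n} {G : OrientedGraph n} → (Fin n → Bool) → Signature G → Signature G
switch S σ u v a = (σ u v a xor S u) xor S v

SwitchEquivalent : ∀ {n} {G : OrientedGraph n} → Signature G → Signature G → Set
SwitchEquivalent {n} {G} σ σ' =
  Σ (Fin n → Bool) λ S → ∀ u v (a : Arc G u v ≡ true) → switch {G = G} S σ u v a ≡ σ' u v a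

-- Across every edge both endpoints change side or neither does, so the set D of
-- vertices that change side is a union of components.  The two signatures differ
-- exactly on the edges inside D, and each such edge has exactly one endpoint in
-- the old part B; switching D ∩ B therefore turns one signature into the other.
module Submission where

open import Defs
open import Data.Nat using (ℕ)
open import Data.Fin using (Fin)
open import Data.Bool using (Bool; true; not; _xor_; _∧_)
open import Data.Bool.Properties
  using (¬-not; xor-assoc; xor-same; xor-inverseˡ; xor-annihilates-not; ∧-distribˡ-xor; ∧-identityʳ)
open import Data.Product using (_,_)
open import Relation.Binary.PropositionalEquality using (_≡_; _≢_; sym; cong; cong₂; module ≡-Reasoning)
open ≡-Reasoning

xor-≢ : ∀ {x y} → x ≢ y → x xor y ≡ true
xor-≢ {y = y} x≢y rewrite ¬-not x≢y = xor-inverseˡ y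

xor-cancelˡ : ∀ x y → x xor (x xor y) ≡ y
xor-cancelˡ x y = begin
  x xor (x xor y) ≡⟨ sym (xor-assoc x x y) ⟩
  (x xor x) xor y ≡⟨ cong (_xor y) (xor-same x) ⟩
  y               ∎

sideChange : ∀ {n} (side side' : Fin n → Bool) → Fin n → Bool
sideChange side side' w = side w xor side' w

changedInB : ∀ {n} (side side' : Fin n → Bool) → Fin n → Bool
changedInB side side' w = sideChange side side' w ∧ side w

module _ {n : ℕ} (G : OrientedGraph n) where

  switch-xor : ∀ (S : Fin n → Bool) (σ : Signature G) u v (a : Arc G u v ≡ true) →
               switch {G = G} S σ u v a ≡ σ u v a xor (S u xor S v)
  switch-xor S σ u v a = xor-assoc (σ u v a) (S u) (S v)

  bipartition-xor : ∀ {side} → IsBipartition G side →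
                    ∀ u v → Arc G u v ≡ true → side u xor side v ≡ true
  bipartition-xor bip u v a = xor-≢ (bip u v a)

  bipartition-opposite : ∀ {side} → IsBipartition G side →
                         ∀ u v → Arc G u v ≡ true → side u ≡ not (side v)
  bipartition-opposite bip u v a = ¬-not (bip u v a)

  sideChange-edge : ∀ {side side'} → IsBipartition G side → IsBipartition G side' →
                    ∀ u v → Arc G u v ≡ true → sideChange side side' u ≡ sideChange side side' v
  sideChange-edge {side} {side'} bip bip' u v a = begin
    side u xor side' u             ≡⟨ cong₂ _xor_ (bipartition-opposite bip u v a) (bipartition-opposite bip' u v a) ⟩
    not (side v) xor not (side' v) ≡⟨ xor-annihilates-not (side v) (side' v) ⟩
    side v xor side' v             ∎

  changedInB-edge : ∀ {side side'} → IsBipartition G side → IsBipartition G side' →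
                    ∀ u v → Arc G u v ≡ true →
                    changedInB side side' u xor changedInB side side' v ≡ sideChange side side' u
  changedInB-edge {side} {side'} bip bip' u v a = begin
    (D u ∧ side u) xor (D v ∧ side v) ≡⟨ cong (λ d → (D u ∧ side u) xor (d ∧ side v)) (sym (sideChange-edge bip bip' u v a)) ⟩
    (D u ∧ side u) xor (D u ∧ side v) ≡⟨ sym (∧-distribˡ-xor (D u) (side u) (side v)) ⟩
    D u ∧ (side u xor side v)         ≡⟨ cong (D u ∧_) (bipartition-xor bip u v a) ⟩
    D u ∧ true                        ≡⟨ ∧-identityʳ (D u) ⟩
    D u                               ∎
    where
    D : Fin n → Bool
    D = sideChange side side'

mainTheorem10 : ∀ (n : ℕ) (G : OrientedGraph n) (side side' : Fin n → Bool) →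
                IsBipartition G side → IsBipartition G side' →
                SwitchEquivalent {G = G} (associated G side) (associated G side')
mainTheorem10 n G side side' bip bip' = changedInB side side' , switches
  where
  switches : ∀ u v (a : Arc G u v ≡ true) →
             switch {G = G} (changedInB side side') (associated G side) u v a ≡ side' u
  switches u v a = begin
    switch {G = G} (changedInB side side') (associated G side) u v a
      ≡⟨ switch-xor G (changedInB side side') (associated G side) u v a ⟩
    side u xor (changedInB side side' u xor changedInB side side' v)
      ≡⟨ cong (side u xor_) (changedInB-edge G bip bip' u v a) ⟩
    side u xor (side u xor side' u)
      ≡⟨ xor-cancelˡ (side u) (side' u) ⟩
    side' u ∎
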